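{- Let $n>2$. Then the set of values $\{(n-1)\text{ -affinity}(f): f\in\mathrm{Per}(\mathbb{F}_2^n)\}$ equals $\{2^i-2: 1\le i\le n+1\}$.
   Context: $\mathrm{Per}(\mathbb{F}_2^n)$ is the group of permutations of $\mathbb{F}_2^n$. An $(n-1)$-flat is a coset of an $(n-1)$-dimensional subspace; $(n-1)\text{ -affinity}(f)$ is the number of $(n-1)$-flats $X$ such that $f(X)$ is also an $(n-1)$-flat. -}

module Defs where

open import Data.Nat using (ℕ; zero; suc)
open import Data.Bool using (Bool; true; false; _xor_; _∧_; _∨_; if_then_else_)
open import Data.Vec using (Vec; []; _∷_; zipWith; replicate)
open import Data.List using (List; []; _∷_; _++_; map; length)
open import Data.Product using (Σ; ∃; _×_; _,_)
open import Relation.Binary.PropositionalEquality using (_≡_)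
open import Function.Bundles using (_⇔_; _↔_; Inverse)
open import Function.Definitions using (Injective)
open import Data.List.Membership.Propositional using (_∈_)
open import Data.List.Relation.Unary.Unique.Propositional using (Unique)

-- F₂ⁿ : vectors of booleans (false = 0, true = 1, addition = xor)
V : ℕ → Set
V n = Vec Bool n

_⊕_ : ∀ {n} → V n → V n → V n
_⊕_ = zipWith _xor_

zeroV : ∀ {n} → V n
zeroV = replicate _ false

eqB : Bool → Bool → Bool
eqB true  b = b
eqB false b = if b then false else true

eqV : ∀ {n} → V n → V n → Bool
eqV []       []       = true
eqV (x ∷ xs) (y ∷ ys) = eqB x y ∧ eqV xs ys

allV : (n : ℕ) → List (V n)
allV zero    = [] ∷ []
allV (suc n) = map (false ∷_) (allV n) ++ map (true ∷_) (allV n)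

comb : ∀ {n k} → Vec (V n) k → V k → V n
comb []       []       = zeroV
comb (b ∷ bs) (l ∷ ls) = (if l then b else zeroV) ⊕ comb bs ls

-- Subsets of F₂ⁿ, represented as full binary trees of booleans (a first-order
-- data type, so propositional equality coincides with equality of subsets).
Sub : ℕ → Set
Sub zero    = Bool
Sub (suc n) = Sub n × Sub n

_∈?_ : ∀ {n} → V n → Sub n → Bool
_∈?_ {zero}  []          b        = b
_∈?_ {suc n} (false ∷ x) (S₀ , S₁) = x ∈? S₀
_∈?_ {suc n} (true  ∷ x) (S₀ , S₁) = x ∈? S₁

tab : ∀ {n} → (V n → Bool) → Sub n
tab {zero}  p = p []
tab {suc n} p = tab (λ x → p (false ∷ x)) , tab (λ x → p (true ∷ x))

anyL : ∀ {A : Set} → (A → Bool) → List A → Bool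
anyL p []       = false
anyL p (x ∷ xs) = p x ∨ anyL p xs

image : ∀ {n} → (V n → V n) → Sub n → Sub n
image {n} f X = tab (λ y → anyL (λ x → (x ∈? X) ∧ eqV (f x) y) (allV n))

-- X is a k-flat: a coset v + W of a k-dimensional subspace W of F₂ⁿ,
-- W being the span of k linearly independent vectors b₁,…,b_k
-- (linear independence = injectivity of λ ↦ Σ λ_i b_i).
IsFlat : ∀ {n} (k : ℕ) → Sub n → Set
IsFlat {n} k X =
  Σ (V n) λ v → Σ (Vec (V n) k) λ b →
    Injective _≡_ _≡_ (comb b) ×
    (∀ x → (x ∈? X ≡ true) ⇔ (∃ λ l → x ≡ v ⊕ comb b l))

Per : ℕ → Set
Per n = V n ↔ V n

-- "the number of k-flats X with f(X) a k-flat equals m":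
-- there is a duplicate-free list of exactly these subsets, of length m.
AffinityIs : ∀ {n} (k : ℕ) → Per n → ℕ → Set
AffinityIs {n} k f m =
  Σ (List (Sub n)) λ L → Unique L × length L ≡ m ×
    (∀ X → (X ∈ L) ⇔ (IsFlat k X × IsFlat k (image (Inverse.to f) X)))

-- A flat of codimension one is exactly a hyperplane {x : a · x = c} with a ≠ 0. If X and f(X) are the
-- hyperplanes a · x = c and b · y = d, then b · f(x) = a · x + c + d, so the component b · f is affine;
-- conversely every b ≠ 0 with b · f affine gives the two flats f⁻¹{y : b · y = c} with this property.
-- Hence the (n-1)-affinity of f is 2(|S| - 1) for the subspace S = {b : b · f affine}; as |S| = 2ᵈ with
-- d ≤ n, the affinity is 2ᵈ⁺¹ - 2. Conversely S is multiplicative under products g × h, so products of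
-- the identity of F₂ᵈ (where S is everything) with a few small permutations having |S| = 1, 2 or 4
-- realise every d ≤ n as soon as n ≥ 3.

module Submission where

open import Defs
open import Data.Nat using (ℕ; zero; suc; _+_; _*_; _^_; _∸_; _≤_; _<_; _≤ᵇ_; z≤n; s≤s)
open import Data.Nat.Properties
  using (+-suc; +-identityʳ; *-identityˡ; *-assoc; *-distribʳ-+; *-distribˡ-∸; *-cancelˡ-≡; m∸n+n≡m;
         ≤-reflexive; ≤-trans; ≤-antisym; m≤n⇒m≤1+n; <-irrefl; <⇒≱; n<1+n; ^-monoʳ-<; module ≤-Reasoning)
open import Data.Product using (Σ; ∃; _×_; _,_; proj₁; proj₂)
open import Data.Sum using (_⊎_; inj₁; inj₂)
open import Data.Empty using (⊥-elim)
open import Data.Maybe using (fromMaybe)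
open import Data.Bool using (Bool; true; false; not; _xor_; _∧_; _∨_; if_then_else_)
import Data.Bool as Bool
open import Data.Bool.Properties
  using (xor-assoc; xor-comm; xor-identityˡ; xor-identityʳ; xor-same; xor-∧-commutativeRing;
         ∧-conicalˡ; ∧-conicalʳ; ∧-distribˡ-xor; ∧-distribʳ-xor; ∧-identityʳ; ∧-zeroʳ; ∨-zeroʳ;
         not-injective; T-≡)
open import Data.Bool.ListAction using (all)
open import Data.Vec using (Vec; []; _∷_; zipWith; take; drop) renaming (_++_ to _++ᵛ_)
import Data.Vec as Vec
open import Data.Vec.Properties
  using (zipWith-assoc; zipWith-identityˡ; ∷-injectiveˡ; ∷-injectiveʳ; ≡-dec;
         take++drop≡id; ++-injectiveˡ; ++-injectiveʳ)
open import Data.List using (List; []; _∷_; _++_; map; length; filterᵇ; head; findᵇ)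
import Data.List as List
open import Data.List.Properties using (length-++; length-map; filter-++)
open import Data.List.Membership.Propositional using (_∈_)
open import Data.List.Membership.Propositional.Properties
  using (∈-filter⁺; ∈-filter⁻; ∈-++⁺ˡ; ∈-++⁺ʳ; ∈-++⁻; ∈-∃++; ∈-map⁺; ∈-map⁻)
open import Data.List.Relation.Binary.Subset.Propositional using (_⊆_)
open import Data.List.Relation.Unary.Any using (here; there; any?)
open import Data.List.Relation.Unary.All as All using (All)
open import Data.List.Relation.Unary.All.Properties using (all⁺; all⁻)
open import Data.List.Relation.Unary.Unique.Propositional using (Unique; []; _∷_)
import Data.List.Relation.Unary.Unique.Propositional.Properties as UP
open import Function using (_∘_; id)
open import Function.Bundles using (_⇔_; mk⇔; Equivalence; Inverse; mk↔ₛ′; Injection)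
open import Function.Construct.Identity using (↔-id)
open import Function.Definitions using (Injective)
open import Function.Properties.Inverse using (↔⇒↣)
open import Relation.Binary.Definitions using (DecidableEquality)
open import Relation.Binary.PropositionalEquality
  using (_≡_; _≢_; refl; sym; trans; cong; cong₂; subst; module ≡-Reasoning)
open import Relation.Nullary using (¬_; yes; no; contradiction)
open import Relation.Nullary.Decidable using (T?)
open import Algebra.Bundles using (CommutativeRing)
open import Algebra.Properties.CommutativeSemigroup
  (CommutativeRing.+-commutativeSemigroup xor-∧-commutativeRing)
  using (xy∙z≈y∙xz) renaming (interchange to xor-interchange)

eqB⇒≡ : ∀ {p q} → eqB p q ≡ true → p ≡ q
eqB⇒≡ {true}  {true}  _ = refl
eqB⇒≡ {false} {false} _ = refl

eqB-refl : ∀ p → eqB p p ≡ true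
eqB-refl true  = refl
eqB-refl false = refl

≡⇒eqB : ∀ {p q} → p ≡ q → eqB p q ≡ true
≡⇒eqB {p} refl = eqB-refl p

eqB-not : ∀ p c → eqB (not p) c ≡ not (eqB p c)
eqB-not true  true  = refl
eqB-not true  false = refl
eqB-not false true  = refl
eqB-not false false = refl

eqB-xorˡ : ∀ p q c → eqB (p xor q) c ≡ eqB p (q xor c)
eqB-xorˡ true  true  true  = refl
eqB-xorˡ true  true  false = refl
eqB-xorˡ true  false c     = refl
eqB-xorˡ false true  true  = refl
eqB-xorˡ false true  false = refl
eqB-xorˡ false false c     = refl

eqB-injectiveˡ : ∀ {p q} c → eqB p c ≡ eqB q c → p ≡ q
eqB-injectiveˡ {true}  {true}  _ _ = refl
eqB-injectiveˡ {false} {false} _ _ = refl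
eqB-injectiveˡ {true}  {false} true  ()
eqB-injectiveˡ {true}  {false} false ()
eqB-injectiveˡ {false} {true}  true  ()
eqB-injectiveˡ {false} {true}  false ()

xor-cancelʳ : ∀ p q → (p xor q) xor q ≡ p
xor-cancelʳ p q = trans (xor-assoc p q q) (trans (cong (p xor_) (xor-same q)) (xor-identityʳ p))

≡true⇔⇒≡ : ∀ {p q} → (p ≡ true → q ≡ true) → (q ≡ true → p ≡ true) → p ≡ q
≡true⇔⇒≡ {true}  {true}  _ _ = refl
≡true⇔⇒≡ {false} {false} _ _ = refl
≡true⇔⇒≡ {true}  {false} f _ = sym (f refl)
≡true⇔⇒≡ {false} {true}  _ g = g refl

eqV⇒≡ : ∀ {n} {x y : V n} → eqV x y ≡ true → x ≡ y
eqV⇒≡ {x = []}    {[]}    _ = refl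
eqV⇒≡ {x = a ∷ x} {b ∷ y} e =
  cong₂ _∷_ (eqB⇒≡ (∧-conicalˡ _ _ e)) (eqV⇒≡ (∧-conicalʳ _ _ e))

eqV-refl : ∀ {n} (x : V n) → eqV x x ≡ true
eqV-refl []      = refl
eqV-refl (a ∷ x) = cong₂ _∧_ (eqB-refl a) (eqV-refl x)

≡⇒eqV : ∀ {n} {x y : V n} → x ≡ y → eqV x y ≡ true
≡⇒eqV {x = x} refl = eqV-refl x

⊕-assoc : ∀ {n} (x y z : V n) → (x ⊕ y) ⊕ z ≡ x ⊕ (y ⊕ z)
⊕-assoc = zipWith-assoc xor-assoc

⊕-identityˡ : ∀ {n} (x : V n) → zeroV ⊕ x ≡ x
⊕-identityˡ = zipWith-identityˡ xor-identityˡ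

⊕-self : ∀ {n} (x : V n) → x ⊕ x ≡ zeroV
⊕-self []      = refl
⊕-self (a ∷ x) = cong₂ _∷_ (xor-same a) (⊕-self x)

⊕-cancelˡ : ∀ {n} (t x : V n) → t ⊕ (t ⊕ x) ≡ x
⊕-cancelˡ t x = begin
  t ⊕ (t ⊕ x)  ≡⟨ ⊕-assoc t t x ⟨
  (t ⊕ t) ⊕ x  ≡⟨ cong (_⊕ x) (⊕-self t) ⟩
  zeroV ⊕ x    ≡⟨ ⊕-identityˡ x ⟩
  x            ∎
  where open ≡-Reasoning

⊕-injectiveʳ : ∀ {n} (t : V n) {x y} → t ⊕ x ≡ t ⊕ y → x ≡ y
⊕-injectiveʳ t {x} {y} e = trans (sym (⊕-cancelˡ t x)) (trans (cong (t ⊕_) e) (⊕-cancelˡ t y))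

infix 7 _·_

_·_ : ∀ {n} → V n → V n → Bool
[]       · []       = false
(a ∷ as) · (x ∷ xs) = (a ∧ x) xor (as · xs)

·-zeroˡ : ∀ {n} (x : V n) → zeroV · x ≡ false
·-zeroˡ []      = refl
·-zeroˡ (_ ∷ x) = ·-zeroˡ x

·-zeroʳ : ∀ {n} (a : V n) → a · zeroV ≡ false
·-zeroʳ []      = refl
·-zeroʳ (a ∷ as) = trans (cong (_xor (as · zeroV)) (∧-zeroʳ a)) (·-zeroʳ as)

·-distribˡ-⊕ : ∀ {n} (a x y : V n) → a · (x ⊕ y) ≡ a · x xor a · y
·-distribˡ-⊕ []       []       []       = refl
·-distribˡ-⊕ (a ∷ as) (x ∷ xs) (y ∷ ys) = begin
  (a ∧ (x xor y)) xor as · (xs ⊕ ys)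
    ≡⟨ cong₂ _xor_ (∧-distribˡ-xor a x y) (·-distribˡ-⊕ as xs ys) ⟩
  ((a ∧ x) xor (a ∧ y)) xor (as · xs xor as · ys)
    ≡⟨ xor-interchange (a ∧ x) (a ∧ y) (as · xs) (as · ys) ⟩
  ((a ∧ x) xor as · xs) xor ((a ∧ y) xor as · ys)
    ∎
  where open ≡-Reasoning

·-distribʳ-⊕ : ∀ {n} (a b x : V n) → (a ⊕ b) · x ≡ a · x xor b · x
·-distribʳ-⊕ []       []       []       = refl
·-distribʳ-⊕ (a ∷ as) (b ∷ bs) (x ∷ xs) = begin
  ((a xor b) ∧ x) xor (as ⊕ bs) · xs
    ≡⟨ cong₂ _xor_ (∧-distribʳ-xor x a b) (·-distribʳ-⊕ as bs xs) ⟩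
  ((a ∧ x) xor (b ∧ x)) xor (as · xs xor bs · xs)
    ≡⟨ xor-interchange (a ∧ x) (b ∧ x) (as · xs) (bs · xs) ⟩
  ((a ∧ x) xor as · xs) xor ((b ∧ x) xor bs · xs)
    ∎
  where open ≡-Reasoning

·-head : ∀ {n} (a : Bool) (as : V n) → (a ∷ as) · (true ∷ zeroV) ≡ a
·-head a as = trans (cong₂ _xor_ (∧-identityʳ a) (·-zeroʳ as)) (xor-identityʳ a)

·-tail : ∀ {n} (a : Bool) (as x : V n) → (a ∷ as) · (false ∷ x) ≡ as · x
·-tail a as x = cong (_xor as · x) (∧-zeroʳ a)

·-surjective : ∀ {n} {a : V n} → a ≢ zeroV → ∀ c → ∃ λ v → a · v ≡ c
·-surjective {a = a}          _   false = zeroV , ·-zeroʳ a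
·-surjective {a = []}         a≢0 true  = ⊥-elim (a≢0 refl)
·-surjective {a = true ∷ as}  _   true  = true ∷ zeroV , ·-head true as
·-surjective {a = false ∷ as} a≢0 true  =
  let u , au = ·-surjective (a≢0 ∘ cong (false ∷_)) true in false ∷ u , au

·-injective : ∀ {n} {a b : V n} → (∀ x → a · x ≡ b · x) → a ≡ b
·-injective {a = []}     {[]}     _ = refl
·-injective {a = a ∷ as} {b ∷ bs} h = cong₂ _∷_
  (trans (sym (·-head a as)) (trans (h (true ∷ zeroV)) (·-head b bs)))
  (·-injective λ x → trans (sym (·-tail a as x)) (trans (h (false ∷ x)) (·-tail b bs x)))

·-⊕-orthogonal : ∀ {n} (a v : V n) {w} → a · w ≡ false → a · (v ⊕ w) ≡ a · v
·-⊕-orthogonal a v {w} aw = trans (·-distribˡ-⊕ a v w) (trans (cong (a · v xor_) aw) (xor-identityʳ _))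

nonzeroᵇ : ∀ {n} → V n → Bool
nonzeroᵇ x = not (eqV x zeroV)

nonzeroᵇ⇒≢0 : ∀ {n} {x : V n} → nonzeroᵇ x ≡ true → x ≢ zeroV
nonzeroᵇ⇒≢0 {n} e refl with () ← trans (sym e) (cong not (eqV-refl (zeroV {n})))

≢0⇒nonzeroᵇ : ∀ {n} {x : V n} → x ≢ zeroV → nonzeroᵇ x ≡ true
≢0⇒nonzeroᵇ {x = x} x≢0 with eqV x zeroV in e
... | true  = ⊥-elim (x≢0 (eqV⇒≡ e))
... | false = refl

¬nonzeroᵇ⇒≡0 : ∀ {n} {x : V n} → nonzeroᵇ x ≡ false → x ≡ zeroV
¬nonzeroᵇ⇒≡0 e = eqV⇒≡ (not-injective e)

private variable
  A B : Set

count : (A → Bool) → List A → ℕ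
count p xs = length (filterᵇ p xs)

count-++ : ∀ (p : A → Bool) xs ys → count p (xs ++ ys) ≡ count p xs + count p ys
count-++ p xs ys = trans (cong length (filter-++ (T? ∘ p) xs ys)) (length-++ (filterᵇ p xs))

count-map : ∀ (p : B → Bool) (g : A → B) xs → count p (map g xs) ≡ count (p ∘ g) xs
count-map p g []       = refl
count-map p g (x ∷ xs) with p (g x)
... | true  = cong suc (count-map p g xs)
... | false = count-map p g xs

count-cong : ∀ {p q : A → Bool} → (∀ x → p x ≡ q x) → ∀ xs → count p xs ≡ count q xs
count-cong             h []       = refl
count-cong {p = p} {q} h (x ∷ xs) with p x | q x | h x
... | true  | .true  | refl = cong suc (count-cong h xs)
... | false | .false | refl = count-cong h xs

count-not : ∀ (p : A → Bool) xs → count p xs + count (not ∘ p) xs ≡ length xs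
count-not p []       = refl
count-not p (x ∷ xs) with p x
... | true  = cong suc (count-not p xs)
... | false = trans (+-suc (count p xs) _) (cong suc (count-not p xs))

count-false : ∀ (xs : List A) → count (λ _ → false) xs ≡ 0
count-false []       = refl
count-false (_ ∷ xs) = count-false xs

count-true : ∀ (xs : List A) → count (λ _ → true) xs ≡ length xs
count-true []       = refl
count-true (_ ∷ xs) = cong suc (count-true xs)

∈-filterᵇ⁺ : ∀ (p : A → Bool) {x xs} → x ∈ xs → p x ≡ true → x ∈ filterᵇ p xs
∈-filterᵇ⁺ p x∈xs px = ∈-filter⁺ (T? ∘ p) x∈xs (Equivalence.from T-≡ px)

∈-filterᵇ⁻ : ∀ (p : A → Bool) xs {x} → x ∈ filterᵇ p xs → x ∈ xs × p x ≡ true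
∈-filterᵇ⁻ p xs x∈ = let x∈xs , px = ∈-filter⁻ (T? ∘ p) x∈ in x∈xs , Equivalence.to T-≡ px

anyL⁺ : ∀ (p : A → Bool) {x xs} → x ∈ xs → p x ≡ true → anyL p xs ≡ true
anyL⁺ p {xs = y ∷ ys} (here refl) px = cong (_∨ anyL p ys) px
anyL⁺ p {xs = y ∷ ys} (there x∈)  px = trans (cong (p y ∨_) (anyL⁺ p x∈ px)) (∨-zeroʳ (p y))

anyL⁻ : ∀ (p : A → Bool) xs → anyL p xs ≡ true → ∃ λ x → x ∈ xs × p x ≡ true
anyL⁻ p (y ∷ ys) e with p y in py
... | true  = y , here refl , py
... | false = let x , x∈ , px = anyL⁻ p ys e in x , there x∈ , px

⊆⇒length≤ : ∀ {xs ys : List A} → Unique xs → xs ⊆ ys → length xs ≤ length ys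
⊆⇒length≤ {xs = []}     _             _     = z≤n
⊆⇒length≤ {xs = x ∷ xs} (x∉xs ∷ uniq) xs⊆ys with ∈-∃++ (xs⊆ys (here refl))
... | ys₁ , ys₂ , refl = begin
  suc (length xs)                  ≤⟨ s≤s (⊆⇒length≤ uniq xs⊆ys₁ys₂) ⟩
  suc (length (ys₁ ++ ys₂))        ≡⟨ cong suc (length-++ ys₁) ⟩
  suc (length ys₁ + length ys₂)    ≡⟨ +-suc (length ys₁) (length ys₂) ⟨
  length ys₁ + length (x ∷ ys₂)    ≡⟨ length-++ ys₁ ⟨
  length (ys₁ ++ x ∷ ys₂)          ∎
  where
  open ≤-Reasoning
  xs⊆ys₁ys₂ : xs ⊆ ys₁ ++ ys₂
  xs⊆ys₁ys₂ {y} y∈xs with ∈-++⁻ ys₁ (xs⊆ys (there y∈xs))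
  ... | inj₁ y∈ys₁           = ∈-++⁺ˡ y∈ys₁
  ... | inj₂ (here refl)     = ⊥-elim (All.lookup x∉xs y∈xs refl)
  ... | inj₂ (there y∈ys₂)   = ∈-++⁺ʳ ys₁ y∈ys₂

∈⇔⇒length≡ : ∀ {xs ys : List A} → Unique xs → Unique ys →
             (∀ x → x ∈ xs ⇔ x ∈ ys) → length xs ≡ length ys
∈⇔⇒length≡ uxs uys h = ≤-antisym
  (⊆⇒length≤ uxs (Equivalence.to (h _)))
  (⊆⇒length≤ uys (Equivalence.from (h _)))

length≤⇒⊇ : DecidableEquality A → ∀ {xs ys : List A} →
            Unique xs → xs ⊆ ys → length ys ≤ length xs → ys ⊆ xs
length≤⇒⊇ _≟_ {xs = xs} {ys} uxs xs⊆ys ys≤xs {y} y∈ys with any? (y ≟_) xs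
... | yes y∈xs = y∈xs
... | no  y∉xs = ⊥-elim (<-irrefl refl (≤-trans (⊆⇒length≤ (y∉ ∷ uxs) yxs⊆ys) ys≤xs))
  where
  y∉ : All (y ≢_) xs
  y∉ = All.tabulate λ z∈xs y≡z → y∉xs (subst (_∈ xs) (sym y≡z) z∈xs)
  yxs⊆ys : y ∷ xs ⊆ ys
  yxs⊆ys (here refl) = y∈ys
  yxs⊆ys (there z∈)  = xs⊆ys z∈

∈-allV : ∀ {n} (x : V n) → x ∈ allV n
∈-allV []                  = here refl
∈-allV         (false ∷ x) = ∈-++⁺ˡ (∈-map⁺ (false ∷_) (∈-allV x))
∈-allV {suc n} (true ∷ x)  = ∈-++⁺ʳ (map (false ∷_) (allV n)) (∈-map⁺ (true ∷_) (∈-allV x))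

allV-unique : ∀ n → Unique (allV n)
allV-unique zero    = All.[] ∷ []
allV-unique (suc n) =
  UP.++⁺ (UP.map⁺ ∷-injectiveʳ (allV-unique n)) (UP.map⁺ ∷-injectiveʳ (allV-unique n)) disjoint
  where
  disjoint : ∀ {x} → ¬ (x ∈ map (false ∷_) (allV n) × x ∈ map (true ∷_) (allV n))
  disjoint (x∈₀ , x∈₁) with ∈-map⁻ (false ∷_) x∈₀ | ∈-map⁻ (true ∷_) x∈₁
  ... | _ , _ , refl | _ , _ , ()

length-allV : ∀ n → length (allV n) ≡ 2 ^ n
length-allV zero    = refl
length-allV (suc n) = begin
  length (map (false ∷_) (allV n) ++ map (true ∷_) (allV n))
    ≡⟨ length-++ (map (false ∷_) (allV n)) ⟩
  length (map (false ∷_) (allV n)) + length (map (true ∷_) (allV n))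
    ≡⟨ cong₂ _+_ (length-map (false ∷_) (allV n)) (length-map (true ∷_) (allV n)) ⟩
  length (allV n) + length (allV n)
    ≡⟨ cong (λ k → k + k) (length-allV n) ⟩
  2 ^ n + 2 ^ n
    ≡⟨ cong (2 ^ n +_) (+-identityʳ (2 ^ n)) ⟨
  2 ^ suc n ∎
  where open ≡-Reasoning

all-allV⁻ : ∀ {n} (p : V n → Bool) → all p (allV n) ≡ true → ∀ x → p x ≡ true
all-allV⁻ p e x = Equivalence.to T-≡ (All.lookup (all⁺ p (allV _) (Equivalence.from T-≡ e)) (∈-allV x))

all-allV⁺ : ∀ {n} (p : V n → Bool) → (∀ x → p x ≡ true) → all p (allV n) ≡ true
all-allV⁺ {n} p h =
  Equivalence.to T-≡ (all⁻ p (All.tabulate {xs = allV n} λ {x} _ → Equivalence.from T-≡ (h x)))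

count-allV-suc : ∀ {n} (p : V (suc n) → Bool) →
  count p (allV (suc n)) ≡ count (p ∘ (false ∷_)) (allV n) + count (p ∘ (true ∷_)) (allV n)
count-allV-suc {n} p = trans (count-++ p (map (false ∷_) (allV n)) _)
  (cong₂ _+_ (count-map p (false ∷_) (allV n)) (count-map p (true ∷_) (allV n)))

count-allV-↔ : ∀ {n} (f : Per n) (p : V n → Bool) →
  count (p ∘ Inverse.to f) (allV n) ≡ count p (allV n)
count-allV-↔ {n} f p = trans (sym (length-map to (filterᵇ (p ∘ to) (allV n))))
  (∈⇔⇒length≡ (UP.map⁺ (Injection.injective (↔⇒↣ f)) (UP.filter⁺ (T? ∘ p ∘ to) (allV-unique n)))
              (UP.filter⁺ (T? ∘ p) (allV-unique n))
              (λ y → mk⇔ forth (back y)))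
  where
  open Inverse f using (to; from; strictlyInverseˡ)
  forth : ∀ {y} → y ∈ map to (filterᵇ (p ∘ to) (allV n)) → y ∈ filterᵇ p (allV n)
  forth y∈ with ∈-map⁻ to {xs = filterᵇ (p ∘ to) (allV n)} y∈
  ... | x , x∈ , refl = ∈-filterᵇ⁺ p (∈-allV (to x)) (proj₂ (∈-filterᵇ⁻ (p ∘ to) (allV n) x∈))
  back : ∀ y → y ∈ filterᵇ p (allV n) → y ∈ map to (filterᵇ (p ∘ to) (allV n))
  back y y∈ = subst (_∈ _) (strictlyInverseˡ y) (∈-map⁺ to (∈-filterᵇ⁺ (p ∘ to) (∈-allV (from y))
    (trans (cong p (strictlyInverseˡ y)) (proj₂ (∈-filterᵇ⁻ p (allV n) y∈)))))

translation : ∀ {n} → V n → Per n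
translation t = mk↔ₛ′ (t ⊕_) (t ⊕_) (⊕-cancelˡ t) (⊕-cancelˡ t)

no-injection-suc : ∀ {m} (φ : V (suc m) → V m) → ¬ Injective _≡_ _≡_ φ
no-injection-suc {m} φ inj = <⇒≱ (^-monoʳ-< 2 (s≤s (s≤s z≤n)) (n<1+n m)) (begin
  2 ^ suc m                    ≡⟨ length-allV (suc m) ⟨
  length (allV (suc m))        ≡⟨ length-map φ (allV (suc m)) ⟨
  length (map φ (allV (suc m))) ≤⟨ ⊆⇒length≤ (UP.map⁺ inj (allV-unique (suc m))) (λ {y} _ → ∈-allV y) ⟩
  length (allV m)              ≡⟨ length-allV m ⟩
  2 ^ m                        ∎)
  where open ≤-Reasoning

⊕-Closed : ∀ {n} → (V n → Bool) → Set
⊕-Closed {n} S = ∀ (x y : V n) → S x ≡ true → S y ≡ true → S (x ⊕ y) ≡ true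

-- If S contains some (1 ∷ t), then (1 ∷ x) ∈ S iff (0 ∷ t ⊕ x) ∈ S.
upper-half : ∀ {n} (S : V (suc n) → Bool) → ⊕-Closed S →
  count (S ∘ (true ∷_)) (allV n) ≡ 0 ⊎ count (S ∘ (true ∷_)) (allV n) ≡ count (S ∘ (false ∷_)) (allV n)
upper-half {n} S closed with anyL (S ∘ (true ∷_)) (allV n) in found
... | false = inj₁ (trans (count-cong none (allV n)) (count-false (allV n)))
  where
  none : ∀ x → S (true ∷ x) ≡ false
  none x with S (true ∷ x) in Sx
  ... | false = refl
  ... | true  with () ← trans (sym found) (anyL⁺ (S ∘ (true ∷_)) (∈-allV x) Sx)
... | true = inj₂ (trans (count-cong coset (allV n)) (count-allV-↔ (translation t) (S ∘ (false ∷_))))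
  where
  t = proj₁ (anyL⁻ _ (allV n) found)
  St = proj₂ (proj₂ (anyL⁻ _ (allV n) found))
  coset : ∀ x → S (true ∷ x) ≡ S (false ∷ (t ⊕ x))
  coset x = ≡true⇔⇒≡
    (λ Sx → closed (true ∷ t) (true ∷ x) St Sx)
    (λ Stx → subst (λ z → S (true ∷ z) ≡ true) (⊕-cancelˡ t x) (closed (true ∷ t) (false ∷ (t ⊕ x)) St Stx))

subspace-size : ∀ n (S : V n → Bool) → S zeroV ≡ true → ⊕-Closed S →
  ∃ λ d → d ≤ n × count S (allV n) ≡ 2 ^ d
subspace-size zero S S0 _ with S [] | S0
... | .true | refl = 0 , z≤n , refl
subspace-size (suc n) S S0 closed
  with subspace-size n (S ∘ (false ∷_)) S0 (λ x y → closed (false ∷ x) (false ∷ y)) | upper-half S closed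
... | d , d≤n , |S₀| | inj₁ |S₁|≡0 = d , m≤n⇒m≤1+n d≤n ,
  trans (count-allV-suc S) (trans (cong₂ _+_ |S₀| |S₁|≡0) (+-identityʳ (2 ^ d)))
... | d , d≤n , |S₀| | inj₂ |S₁|≡|S₀| = suc d , s≤s d≤n ,
  trans (count-allV-suc S)
        (trans (cong₂ _+_ |S₀| (trans |S₁|≡|S₀| |S₀|)) (cong (2 ^ d +_) (sym (+-identityʳ (2 ^ d)))))

count-nonzero : ∀ {n} (S : V n → Bool) → S zeroV ≡ true →
  count S (allV n) ≡ suc (count (λ b → nonzeroᵇ b ∧ S b) (allV n))
count-nonzero {zero}  S S0 with S [] | S0
... | .true | refl = refl
count-nonzero {suc n} S S0 = begin
  count S (allV (suc n))
    ≡⟨ count-allV-suc S ⟩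
  count (S ∘ (false ∷_)) (allV n) + S₁
    ≡⟨ cong (_+ S₁) (count-nonzero (S ∘ (false ∷_)) S0) ⟩
  suc (count (λ b → nonzeroᵇ b ∧ S (false ∷ b)) (allV n) + S₁)
    ≡⟨ cong suc (count-allV-suc (λ b → nonzeroᵇ b ∧ S b)) ⟨
  suc (count (λ b → nonzeroᵇ b ∧ S b) (allV (suc n)))
    ∎
  where
  open ≡-Reasoning
  S₁ = count (S ∘ (true ∷_)) (allV n)

∈-tab : ∀ {n} (p : V n → Bool) (x : V n) → x ∈? tab p ≡ p x
∈-tab {zero}  p []          = refl
∈-tab {suc n} p (false ∷ x) = ∈-tab (p ∘ (false ∷_)) x
∈-tab {suc n} p (true ∷ x)  = ∈-tab (p ∘ (true ∷_)) x

Sub-ext : ∀ {n} {X Y : Sub n} → (∀ x → x ∈? X ≡ x ∈? Y) → X ≡ Y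
Sub-ext {zero}                        h = h []
Sub-ext {suc n} {X₀ , X₁} {Y₀ , Y₁} h =
  cong₂ _,_ (Sub-ext (h ∘ (false ∷_))) (Sub-ext (h ∘ (true ∷_)))

preimage : ∀ {n} → (V n → V n) → Sub n → Sub n
preimage g Y = tab (λ x → g x ∈? Y)

∈-image : ∀ {n} (f : Per n) (X : Sub n) (y : V n) →
  y ∈? image (Inverse.to f) X ≡ Inverse.from f y ∈? X
∈-image {n} f X y = trans (∈-tab _ y) (≡true⇔⇒≡ forth back)
  where
  open Inverse f using (to; from; strictlyInverseˡ; strictlyInverseʳ)
  forth : anyL (λ x → (x ∈? X) ∧ eqV (to x) y) (allV n) ≡ true → from y ∈? X ≡ true
  forth e with anyL⁻ _ (allV n) e
  ... | x , _ , hit = subst (λ z → z ∈? X ≡ true)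
    (trans (sym (strictlyInverseʳ x)) (cong from (eqV⇒≡ (∧-conicalʳ (x ∈? X) _ hit))))
    (∧-conicalˡ (x ∈? X) _ hit)
  back : from y ∈? X ≡ true → anyL (λ x → (x ∈? X) ∧ eqV (to x) y) (allV n) ≡ true
  back e = anyL⁺ _ (∈-allV (from y))
    (cong₂ _∧_ e (trans (cong (λ z → eqV z y) (strictlyInverseˡ y)) (eqV-refl y)))

image-preimage : ∀ {n} (f : Per n) (Y : Sub n) → image (Inverse.to f) (preimage (Inverse.to f) Y) ≡ Y
image-preimage f Y = Sub-ext λ y → begin
  y ∈? image to (preimage to Y)  ≡⟨ ∈-image f (preimage to Y) y ⟩
  from y ∈? preimage to Y        ≡⟨ ∈-tab (_∈? Y ∘ to) (from y) ⟩
  to (from y) ∈? Y               ≡⟨ cong (_∈? Y) (strictlyInverseˡ y) ⟩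
  y ∈? Y                         ∎
  where
  open Inverse f using (to; from; strictlyInverseˡ)
  open ≡-Reasoning

preimage-image : ∀ {n} (f : Per n) (X : Sub n) → preimage (Inverse.to f) (image (Inverse.to f) X) ≡ X
preimage-image f X = Sub-ext λ x → begin
  x ∈? preimage to (image to X)  ≡⟨ ∈-tab (_∈? image to X ∘ to) x ⟩
  to x ∈? image to X             ≡⟨ ∈-image f X (to x) ⟩
  from (to x) ∈? X               ≡⟨ cong (_∈? X) (strictlyInverseʳ x) ⟩
  x ∈? X                         ∎
  where
  open Inverse f using (to; from; strictlyInverseʳ)
  open ≡-Reasoning

preimage-injective : ∀ {n} (f : Per n) {Y Y′ : Sub n} →
  preimage (Inverse.to f) Y ≡ preimage (Inverse.to f) Y′ → Y ≡ Y′
preimage-injective f {Y} {Y′} e =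
  trans (sym (image-preimage f Y)) (trans (cong (image (Inverse.to f)) e) (image-preimage f Y′))

-- Hyperplanes are the flats of codimension one

hyperplane : ∀ {n} → V n → Bool → Sub n
hyperplane a c = tab (λ x → eqB (a · x) c)

∈-hyperplane : ∀ {n} (a : V n) c x → x ∈? hyperplane a c ≡ true ⇔ a · x ≡ c
∈-hyperplane a c x = mk⇔
  (λ e → eqB⇒≡ (trans (sym (∈-tab _ x)) e))
  (λ e → trans (∈-tab _ x) (≡⇒eqB e))

hyperplane-injectiveˡ : ∀ {n} {a b : V n} c → hyperplane a c ≡ hyperplane b c → a ≡ b
hyperplane-injectiveˡ {a = a} {b} c e = ·-injective λ x → eqB-injectiveˡ c
  (trans (sym (∈-tab _ x)) (trans (cong (x ∈?_) e) (∈-tab _ x)))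

hyperplane-false≢true : ∀ {n} (a b : V n) → hyperplane a false ≢ hyperplane b true
hyperplane-false≢true a b e = contradiction zero-membership λ ()
  where
  open ≡-Reasoning
  zero-membership : true ≡ false
  zero-membership = begin
    true                              ≡⟨ cong (λ d → eqB d false) (·-zeroʳ a) ⟨
    eqB (a · zeroV) false             ≡⟨ ∈-tab (λ x → eqB (a · x) false) zeroV ⟨
    zeroV ∈? hyperplane a false       ≡⟨ cong (zeroV ∈?_) e ⟩
    zeroV ∈? hyperplane b true        ≡⟨ ∈-tab (λ x → eqB (b · x) true) zeroV ⟩
    eqB (b · zeroV) true              ≡⟨ cong (λ d → eqB d true) (·-zeroʳ b) ⟩
    false                             ∎

-- Translating by some u with a · u = 1 exchanges the hyperplane with its complement.
hyperplane-size : ∀ {m} {a : V (suc m)} → a ≢ zeroV → ∀ c →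
  count (λ x → eqB (a · x) c) (allV (suc m)) ≡ 2 ^ m
hyperplane-size {m} {a} a≢0 c = *-cancelˡ-≡ _ _ 2 (begin
  2 * count p F                      ≡⟨ cong (count p F +_) (+-identityʳ _) ⟩
  count p F + count p F              ≡⟨ cong (count p F +_) complement≡ ⟨
  count p F + count (not ∘ p) F      ≡⟨ count-not p F ⟩
  length F                           ≡⟨ length-allV (suc m) ⟩
  2 * 2 ^ m                          ∎)
  where
  open ≡-Reasoning
  F = allV (suc m)
  p : V (suc m) → Bool
  p x = eqB (a · x) c
  u = proj₁ (·-surjective a≢0 true)
  au = proj₂ (·-surjective a≢0 true)
  flip : ∀ x → p (u ⊕ x) ≡ not (p x)
  flip x = trans (cong (λ d → eqB d c) (trans (·-distribˡ-⊕ a u x) (cong (_xor a · x) au)))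
                 (eqB-not (a · x) c)
  complement≡ : count (not ∘ p) F ≡ count p F
  complement≡ = trans (sym (count-cong flip F)) (count-allV-↔ (translation u) p)

comb-∷ : ∀ {n k} (c : V k) (b : Vec (V n) k) l → comb (zipWith _∷_ c b) l ≡ (c · l) ∷ comb b l
comb-∷ []       []       []         = refl
comb-∷ (c ∷ cs) (b ∷ bs) (true ∷ l)  rewrite comb-∷ cs bs l | ∧-identityʳ c = refl
comb-∷ (c ∷ cs) (b ∷ bs) (false ∷ l) rewrite comb-∷ cs bs l | ∧-zeroʳ c     = refl

extend : ∀ {n k} → Vec (V n) k → Vec (V (suc n)) (suc k)
extend b = (true ∷ zeroV) ∷ zipWith _∷_ zeroV b

comb-extend : ∀ {n k} (b : Vec (V n) k) l₀ l → comb (extend b) (l₀ ∷ l) ≡ l₀ ∷ comb b l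
comb-extend b l₀ l rewrite comb-∷ zeroV b l | ·-zeroˡ l with l₀
... | true  = cong (true ∷_)  (⊕-identityˡ (comb b l))
... | false = cong (false ∷_) (⊕-identityˡ (comb b l))

units : ∀ k → Vec (V k) k
units zero    = []
units (suc k) = extend (units k)

comb-units : ∀ {k} (l : V k) → comb (units k) l ≡ l
comb-units []       = refl
comb-units (l₀ ∷ l) = trans (comb-extend (units _) l₀ l) (cong (l₀ ∷_) (comb-units l))

kernel-basis : ∀ {m} (a : V (suc m)) → a ≢ zeroV →
  ∃ λ (b : Vec (V (suc m)) m) → (∀ l → a · comb b l ≡ false) × Injective _≡_ _≡_ (comb b)
kernel-basis (true ∷ a) _ = zipWith _∷_ a (units _) , orthogonal , injective
  where
  comb≡ : ∀ l → comb (zipWith _∷_ a (units _)) l ≡ (a · l) ∷ l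
  comb≡ l = trans (comb-∷ a (units _) l) (cong (a · l ∷_) (comb-units l))
  orthogonal : ∀ l → (true ∷ a) · comb (zipWith _∷_ a (units _)) l ≡ false
  orthogonal l rewrite comb≡ l = xor-same (a · l)
  injective : Injective _≡_ _≡_ (comb (zipWith _∷_ a (units _)))
  injective {l} {l′} e = ∷-injectiveʳ (trans (sym (comb≡ l)) (trans e (comb≡ l′)))
kernel-basis {zero}  (false ∷ []) a≢0 = ⊥-elim (a≢0 refl)
kernel-basis {suc m} (false ∷ a)  a≢0 with kernel-basis a (a≢0 ∘ cong (false ∷_))
... | b , orth , inj = extend b , orthogonal , injective
  where
  orthogonal : ∀ l → (false ∷ a) · comb (extend b) l ≡ false
  orthogonal (l₀ ∷ l) rewrite comb-extend b l₀ l = orth l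
  injective : Injective _≡_ _≡_ (comb (extend b))
  injective {l₀ ∷ l} {l₀′ ∷ l′} e =
    let e′ = trans (sym (comb-extend b l₀ l)) (trans e (comb-extend b l₀′ l′))
    in cong₂ _∷_ (∷-injectiveˡ e′) (inj (∷-injectiveʳ e′))

-- The coset has 2ᵐ distinct points, all on the hyperplane, which has only 2ᵐ points.
hyperplane⊆coset : ∀ {m} {a : V (suc m)} → a ≢ zeroV → ∀ v (b : Vec (V (suc m)) m) →
  (∀ l → a · comb b l ≡ false) → Injective _≡_ _≡_ (comb b) →
  ∀ x → a · x ≡ a · v → ∃ λ l → x ≡ v ⊕ comb b l
hyperplane⊆coset {m} {a} a≢0 v b orth inj x ax =
  let l , _ , x≡ = ∈-map⁻ point (length≤⇒⊇ (≡-dec Bool._≟_) coset-unique coset⊆H H≤coset x∈H) in l , x≡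
  where
  point : V m → V (suc m)
  point l = v ⊕ comb b l
  coset = map point (allV m)
  p : V (suc m) → Bool
  p y = eqB (a · y) (a · v)
  H = filterᵇ p (allV (suc m))
  coset-unique : Unique coset
  coset-unique = UP.map⁺ (inj ∘ ⊕-injectiveʳ v) (allV-unique m)
  coset⊆H : coset ⊆ H
  coset⊆H y∈ with ∈-map⁻ point y∈
  ... | l , _ , refl = ∈-filterᵇ⁺ p (∈-allV _) (≡⇒eqB (·-⊕-orthogonal a v (orth l)))
  H≤coset : length H ≤ length coset
  H≤coset = ≤-reflexive (trans (hyperplane-size a≢0 (a · v))
                                (sym (trans (length-map point (allV m)) (length-allV m))))
  x∈H : x ∈ H
  x∈H = ∈-filterᵇ⁺ p (∈-allV x) (≡⇒eqB ax)

dotAll : ∀ {n k} → Vec (V n) k → V n → V k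
dotAll b a = Vec.map (a ·_) b

·-comb : ∀ {n k} (a : V n) (b : Vec (V n) k) l → a · comb b l ≡ dotAll b a · l
·-comb a []       []       = ·-zeroʳ a
·-comb a (b ∷ bs) (l ∷ ls) =
  trans (·-distribˡ-⊕ a _ (comb bs ls)) (cong₂ _xor_ (select l) (·-comb a bs ls))
  where
  select : ∀ l → a · (if l then b else zeroV) ≡ a · b ∧ l
  select true  = sym (∧-identityʳ (a · b))
  select false = trans (·-zeroʳ a) (sym (∧-zeroʳ (a · b)))

dotAll-⊕ : ∀ {n k} (b : Vec (V n) k) a a′ → dotAll b (a ⊕ a′) ≡ dotAll b a ⊕ dotAll b a′
dotAll-⊕ []       a a′ = refl
dotAll-⊕ (w ∷ ws) a a′ = cong₂ _∷_ (·-distribʳ-⊕ a a′ w) (dotAll-⊕ ws a a′)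

-- dotAll b : V (suc m) → V m is linear, so by pigeonhole it has a nonzero kernel vector.
kernel-nonzero : ∀ {m} (b : Vec (V (suc m)) m) → ∃ λ a → a ≢ zeroV × (∀ l → a · comb b l ≡ false)
kernel-nonzero {m} b with anyL (λ a → nonzeroᵇ a ∧ eqV (dotAll b a) zeroV) (allV (suc m)) in found
... | true = let a , _ , hit = anyL⁻ _ (allV (suc m)) found in
  a , nonzeroᵇ⇒≢0 (∧-conicalˡ _ _ hit) , λ l → begin
    a · comb b l      ≡⟨ ·-comb a b l ⟩
    dotAll b a · l    ≡⟨ cong (_· l) (eqV⇒≡ {x = dotAll b a} {zeroV} (∧-conicalʳ (nonzeroᵇ a) _ hit)) ⟩
    zeroV · l         ≡⟨ ·-zeroˡ l ⟩
    false             ∎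
  where open ≡-Reasoning
... | false = ⊥-elim (no-injection-suc (dotAll b) injective)
  where
  open ≡-Reasoning
  difference-in-kernel : ∀ {a a′} → dotAll b a ≡ dotAll b a′ → dotAll b (a ⊕ a′) ≡ zeroV
  difference-in-kernel {a} {a′} e = begin
    dotAll b (a ⊕ a′)          ≡⟨ dotAll-⊕ b a a′ ⟩
    dotAll b a ⊕ dotAll b a′   ≡⟨ cong (dotAll b a ⊕_) e ⟨
    dotAll b a ⊕ dotAll b a    ≡⟨ ⊕-self (dotAll b a) ⟩
    zeroV                      ∎
  injective : Injective _≡_ _≡_ (dotAll b)
  injective {a} {a′} e with nonzeroᵇ (a ⊕ a′) in nz
  ... | false = sym (⊕-injectiveʳ a (trans (¬nonzeroᵇ⇒≡0 nz) (sym (⊕-self a))))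
  ... | true  with () ← trans (sym found) (anyL⁺ _ (∈-allV (a ⊕ a′))
                           (cong₂ _∧_ nz (≡⇒eqV {x = dotAll b (a ⊕ a′)} (difference-in-kernel {a} {a′} e))))

IsHyperplane : ∀ {n} → Sub n → Set
IsHyperplane {n} X = ∃ λ (a : V n) → ∃ λ c → a ≢ zeroV × X ≡ hyperplane a c

hyperplane-isFlat : ∀ {m} {a : V (suc m)} → a ≢ zeroV → ∀ c → IsFlat m (hyperplane a c)
hyperplane-isFlat {m} {a} a≢0 c with kernel-basis a a≢0 | ·-surjective a≢0 c
... | b , orth , inj | v , av = v , b , inj , λ x → mk⇔ (forth x) (back x)
  where
  forth : ∀ x → x ∈? hyperplane a c ≡ true → ∃ λ l → x ≡ v ⊕ comb b l
  forth x x∈ = hyperplane⊆coset a≢0 v b orth inj x (trans (Equivalence.to (∈-hyperplane a c x) x∈) (sym av))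
  back : ∀ x → (∃ λ l → x ≡ v ⊕ comb b l) → x ∈? hyperplane a c ≡ true
  back x (l , refl) = Equivalence.from (∈-hyperplane a c x) (trans (·-⊕-orthogonal a v (orth l)) av)

isFlat-hyperplane : ∀ {m} {X : Sub (suc m)} → IsFlat m X → IsHyperplane X
isFlat-hyperplane {m} {X} (v , b , inj , h) with kernel-nonzero b
... | a , a≢0 , orth = a , a · v , a≢0 , Sub-ext λ x → ≡true⇔⇒≡ (forth x) (back x)
  where
  forth : ∀ x → x ∈? X ≡ true → x ∈? hyperplane a (a · v) ≡ true
  forth x x∈ with Equivalence.to (h x) x∈
  ... | l , refl = Equivalence.from (∈-hyperplane a _ _) (·-⊕-orthogonal a v (orth l))
  back : ∀ x → x ∈? hyperplane a (a · v) ≡ true → x ∈? X ≡ true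
  back x x∈ = Equivalence.from (h x)
    (hyperplane⊆coset a≢0 v b orth inj x (Equivalence.to (∈-hyperplane a _ x) x∈))

isFlat⇔isHyperplane : ∀ {m} {X : Sub (suc m)} → IsFlat m X ⇔ IsHyperplane X
isFlat⇔isHyperplane = mk⇔ isFlat-hyperplane λ where
  (a , c , a≢0 , refl) → hyperplane-isFlat a≢0 c

-- Affine Boolean functions

Affine : ∀ {n} → (V n → Bool) → Set
Affine {n} g = ∃ λ (a : V n) → ∃ λ c → ∀ x → g x ≡ a · x xor c

Affine-cong : ∀ {n} {g h : V n → Bool} → (∀ x → g x ≡ h x) → Affine g → Affine h
Affine-cong g≗h (a , c , g≡) = a , c , λ x → trans (sym (g≗h x)) (g≡ x)

Affine-const : ∀ {n} c → Affine {n} (λ _ → c)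
Affine-const c = zeroV , c , λ x → cong (_xor c) (sym (·-zeroˡ x))

Affine-xor : ∀ {n} {g h : V n → Bool} → Affine g → Affine h → Affine (λ x → g x xor h x)
Affine-xor {g = g} {h} (a , c , g≡) (a′ , c′ , h≡) = a ⊕ a′ , c xor c′ , λ x → begin
  g x xor h x                        ≡⟨ cong₂ _xor_ (g≡ x) (h≡ x) ⟩
  (a · x xor c) xor (a′ · x xor c′)  ≡⟨ xor-interchange (a · x) c (a′ · x) c′ ⟩
  (a · x xor a′ · x) xor (c xor c′)  ≡⟨ cong (_xor (c xor c′)) (·-distribʳ-⊕ a a′ x) ⟨
  (a ⊕ a′) · x xor (c xor c′)        ∎
  where open ≡-Reasoning

Δ : ∀ {n} → (V (suc n) → Bool) → V n → Bool
Δ g x = g (true ∷ x) xor g (false ∷ x)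

-- g is affine iff its restriction to x₀ = 0 is affine and its derivative Δ g in direction e₀ is constant.
isAffineᵇ : ∀ {n} → (V n → Bool) → Bool
isAffineᵇ {zero}  g = true
isAffineᵇ {suc n} g = isAffineᵇ (g ∘ (false ∷_)) ∧ all (λ x → eqB (Δ g x) (Δ g zeroV)) (allV n)

isAffineᵇ⇒Affine : ∀ {n} (g : V n → Bool) → isAffineᵇ g ≡ true → Affine g
isAffineᵇ⇒Affine {zero}  g _ = [] , g [] , λ where [] → refl
isAffineᵇ⇒Affine {suc n} g e with isAffineᵇ⇒Affine (g ∘ (false ∷_)) (∧-conicalˡ _ _ e)
... | a , c , g₀≡ = Δ g zeroV ∷ a , c , λ where
    (false ∷ x) → trans (g₀≡ x) (cong (λ d → (d xor a · x) xor c) (sym (∧-zeroʳ (Δ g zeroV))))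
    (true ∷ x)  → begin
      g (true ∷ x)                          ≡⟨ xor-cancelʳ (g (true ∷ x)) (g (false ∷ x)) ⟨
      Δ g x xor g (false ∷ x)               ≡⟨ cong₂ _xor_ (Δ-constant x) (g₀≡ x) ⟩
      Δ g zeroV xor (a · x xor c)           ≡⟨ xor-assoc (Δ g zeroV) (a · x) c ⟨
      (Δ g zeroV xor a · x) xor c           ≡⟨ cong (λ d → (d xor a · x) xor c) (∧-identityʳ (Δ g zeroV)) ⟨
      ((Δ g zeroV ∧ true) xor a · x) xor c  ∎
  where
  open ≡-Reasoning
  Δ-constant : ∀ x → Δ g x ≡ Δ g zeroV
  Δ-constant x = eqB⇒≡ (all-allV⁻ (λ x → eqB (Δ g x) (Δ g zeroV)) (∧-conicalʳ _ _ e) x)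

Affine⇒isAffineᵇ : ∀ {n} (g : V n → Bool) → Affine g → isAffineᵇ g ≡ true
Affine⇒isAffineᵇ {zero}  g _                   = refl
Affine⇒isAffineᵇ {suc n} g (a₀ ∷ a , c , g≡) = cong₂ _∧_
  (Affine⇒isAffineᵇ (g ∘ (false ∷_))
    (a , c , λ x → trans (g≡ (false ∷ x)) (cong (λ d → (d xor a · x) xor c) (∧-zeroʳ a₀))))
  (all-allV⁺ _ λ x → ≡⇒eqB (trans (Δ≡a₀ x) (sym (Δ≡a₀ zeroV))))
  where
  open ≡-Reasoning
  Δ≡a₀ : ∀ x → Δ g x ≡ a₀
  Δ≡a₀ x = begin
    g (true ∷ x) xor g (false ∷ x)
      ≡⟨ cong₂ _xor_ (g≡ (true ∷ x)) (g≡ (false ∷ x)) ⟩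
    (((a₀ ∧ true) xor a · x) xor c) xor (((a₀ ∧ false) xor a · x) xor c)
      ≡⟨ cong₂ (λ d e → ((d xor a · x) xor c) xor ((e xor a · x) xor c)) (∧-identityʳ a₀) (∧-zeroʳ a₀) ⟩
    ((a₀ xor a · x) xor c) xor (a · x xor c)
      ≡⟨ cong (_xor (a · x xor c)) (xor-assoc a₀ (a · x) c) ⟩
    (a₀ xor (a · x xor c)) xor (a · x xor c)
      ≡⟨ xor-cancelʳ a₀ (a · x xor c) ⟩
    a₀
      ∎

isAffineᵇ-cong : ∀ {n} {g h : V n → Bool} → (∀ x → g x ≡ h x) → isAffineᵇ g ≡ isAffineᵇ h
isAffineᵇ-cong {g = g} {h} g≗h = ≡true⇔⇒≡
  (λ e → Affine⇒isAffineᵇ h (Affine-cong g≗h (isAffineᵇ⇒Affine g e)))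
  (λ e → Affine⇒isAffineᵇ g (Affine-cong (sym ∘ g≗h) (isAffineᵇ⇒Affine h e)))

-- Affine components and the (n-1)-affinity

isAffineComponentᵇ : ∀ {n} → (V n → V n) → V n → Bool
isAffineComponentᵇ g b = isAffineᵇ (λ x → b · g x)

affineComponents : ∀ {n} → (V n → V n) → ℕ
affineComponents {n} g = count (isAffineComponentᵇ g) (allV n)

zero-isAffineComponent : ∀ {n} (g : V n → V n) → isAffineComponentᵇ g zeroV ≡ true
zero-isAffineComponent g = Affine⇒isAffineᵇ _ (Affine-cong (λ x → sym (·-zeroˡ (g x))) (Affine-const false))

affineComponents-size : ∀ {n} (g : V n → V n) → ∃ λ d → d ≤ n × affineComponents g ≡ 2 ^ d
affineComponents-size {n} g = subspace-size n (isAffineComponentᵇ g) (zero-isAffineComponent g) closed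
  where
  closed : ⊕-Closed (isAffineComponentᵇ g)
  closed b b′ e e′ = Affine⇒isAffineᵇ _ (Affine-cong (λ x → sym (·-distribʳ-⊕ b b′ (g x)))
    (Affine-xor (isAffineᵇ⇒Affine _ e) (isAffineᵇ⇒Affine _ e′)))

module _ {m} (f : Per (suc m)) where
  open Inverse f using (to; from; strictlyInverseˡ)

  componentFlat : V (suc m) → Bool → Sub (suc m)
  componentFlat b c = preimage to (hyperplane b c)

  ∈-componentFlat : ∀ b c x → x ∈? componentFlat b c ≡ eqB (b · to x) c
  ∈-componentFlat b c x = trans (∈-tab (_∈? hyperplane b c ∘ to) x) (∈-tab (λ y → eqB (b · y) c) (to x))

  component-nonconstant : ∀ {b} → b ≢ zeroV → ∀ c → ¬ (∀ x → b · to x ≡ c)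
  component-nonconstant {b} b≢0 c constant = contradiction (begin
    true                   ≡⟨ proj₂ (·-surjective b≢0 true) ⟨
    b · u                  ≡⟨ cong (b ·_) (strictlyInverseˡ u) ⟨
    b · to (from u)        ≡⟨ constant (from u) ⟩
    c                      ≡⟨ constant (from zeroV) ⟨
    b · to (from zeroV)    ≡⟨ cong (b ·_) (strictlyInverseˡ zeroV) ⟩
    b · zeroV              ≡⟨ ·-zeroʳ b ⟩
    false                  ∎) λ ()
    where
    open ≡-Reasoning
    u = proj₁ (·-surjective b≢0 true)

  componentFlat-flats : ∀ {b} → b ≢ zeroV → Affine (λ x → b · to x) → ∀ c →
    IsFlat m (componentFlat b c) × IsFlat m (image to (componentFlat b c))
  componentFlat-flats {b} b≢0 (a , c₀ , b·to≡) c =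
    Equivalence.from isFlat⇔isHyperplane (a , c₀ xor c , a≢0 , Sub-ext hyperplane≡) ,
    Equivalence.from isFlat⇔isHyperplane (b , c , b≢0 , image-preimage f (hyperplane b c))
    where
    a≢0 : a ≢ zeroV
    a≢0 refl = component-nonconstant b≢0 c₀ λ x → trans (b·to≡ x) (cong (_xor c₀) (·-zeroˡ x))
    hyperplane≡ : ∀ x → x ∈? componentFlat b c ≡ x ∈? hyperplane a (c₀ xor c)
    hyperplane≡ x = begin
      x ∈? componentFlat b c        ≡⟨ ∈-componentFlat b c x ⟩
      eqB (b · to x) c              ≡⟨ cong (λ d → eqB d c) (b·to≡ x) ⟩
      eqB (a · x xor c₀) c          ≡⟨ eqB-xorˡ (a · x) c₀ c ⟩
      eqB (a · x) (c₀ xor c)        ≡⟨ ∈-tab (λ y → eqB (a · y) (c₀ xor c)) x ⟨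
      x ∈? hyperplane a (c₀ xor c)  ∎
      where open ≡-Reasoning

  flats-componentFlat : ∀ {X} → IsFlat m X → IsFlat m (image to X) →
    ∃ λ b → ∃ λ c → b ≢ zeroV × Affine (λ x → b · to x) × X ≡ componentFlat b c
  flats-componentFlat {X} X-flat fX-flat
    with isFlat-hyperplane X-flat | isFlat-hyperplane fX-flat
  ... | a , c , _ , X≡ | b , d , b≢0 , fX≡ = b , d , b≢0 , (a , c xor d , affine) , X≡preimage
    where
    open ≡-Reasoning
    X≡preimage : X ≡ componentFlat b d
    X≡preimage = trans (sym (preimage-image f X)) (cong (preimage to) fX≡)
    affine : ∀ x → b · to x ≡ a · x xor (c xor d)
    affine x = eqB-injectiveˡ d (begin
      eqB (b · to x) d                ≡⟨ ∈-componentFlat b d x ⟨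
      x ∈? componentFlat b d          ≡⟨ cong (x ∈?_) X≡preimage ⟨
      x ∈? X                          ≡⟨ cong (x ∈?_) X≡ ⟩
      x ∈? hyperplane a c             ≡⟨ ∈-tab (λ y → eqB (a · y) c) x ⟩
      eqB (a · x) c                   ≡⟨ cong (eqB (a · x)) (xor-cancelʳ c d) ⟨
      eqB (a · x) ((c xor d) xor d)   ≡⟨ eqB-xorˡ (a · x) (c xor d) d ⟨
      eqB (a · x xor (c xor d)) d     ∎)

  nonzeroAffineComponentᵇ : V (suc m) → Bool
  nonzeroAffineComponentᵇ b = nonzeroᵇ b ∧ isAffineComponentᵇ to b

  affinity : AffinityIs m f (2 * count nonzeroAffineComponentᵇ (allV (suc m)))
  affinity = flats , flats-unique , length-flats , λ X → mk⇔ (flats⇒ X) (flats⇐ X)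
    where
    G = filterᵇ nonzeroAffineComponentᵇ (allV (suc m))
    flats : List (Sub (suc m))
    flats = map (λ b → componentFlat b false) G ++ map (λ b → componentFlat b true) G
    G-unique : Unique G
    G-unique = UP.filter⁺ (T? ∘ nonzeroAffineComponentᵇ) (allV-unique (suc m))
    flats-unique : Unique flats
    flats-unique = UP.++⁺
      (UP.map⁺ (hyperplane-injectiveˡ false ∘ preimage-injective f) G-unique)
      (UP.map⁺ (hyperplane-injectiveˡ true ∘ preimage-injective f) G-unique)
      disjoint
      where
      disjoint : ∀ {X} →
        ¬ (X ∈ map (λ b → componentFlat b false) G × X ∈ map (λ b → componentFlat b true) G)
      disjoint (X∈₀ , X∈₁) with ∈-map⁻ _ X∈₀ | ∈-map⁻ _ X∈₁
      ... | b , _ , refl | b′ , _ , e = hyperplane-false≢true b b′ (preimage-injective f e)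
    length-flats : length flats ≡ 2 * count nonzeroAffineComponentᵇ (allV (suc m))
    length-flats = begin
      length flats                          ≡⟨ length-++ (map (λ b → componentFlat b false) G) ⟩
      length (map _ G) + length (map _ G)   ≡⟨ cong₂ _+_ (length-map _ G) (length-map _ G) ⟩
      length G + length G                   ≡⟨ cong (length G +_) (+-identityʳ (length G)) ⟨
      2 * length G                          ∎
      where open ≡-Reasoning
    G-flats : ∀ {b} → b ∈ G → ∀ c →
      IsFlat m (componentFlat b c) × IsFlat m (image to (componentFlat b c))
    G-flats {b} b∈ = let good = proj₂ (∈-filterᵇ⁻ _ (allV (suc m)) b∈) in
      componentFlat-flats {b} (nonzeroᵇ⇒≢0 (∧-conicalˡ _ _ good))
        (isAffineᵇ⇒Affine (λ x → b · to x) (∧-conicalʳ (nonzeroᵇ b) _ good))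
    flats⇒ : ∀ X → X ∈ flats → IsFlat m X × IsFlat m (image to X)
    flats⇒ X X∈ with ∈-++⁻ (map (λ b → componentFlat b false) G) X∈
    ... | inj₁ X∈₀ with ∈-map⁻ _ X∈₀
    ...   | b , b∈ , refl = G-flats b∈ false
    flats⇒ X X∈ | inj₂ X∈₁ with ∈-map⁻ _ X∈₁
    ...   | b , b∈ , refl = G-flats b∈ true
    flats⇐ : ∀ X → IsFlat m X × IsFlat m (image to X) → X ∈ flats
    flats⇐ X (X-flat , fX-flat) with flats-componentFlat X-flat fX-flat
    ... | b , c , b≢0 , affine , refl = place c
      where
      b∈ : b ∈ G
      b∈ = ∈-filterᵇ⁺ _ (∈-allV b) (cong₂ _∧_ (≢0⇒nonzeroᵇ b≢0) (Affine⇒isAffineᵇ _ affine))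
      place : ∀ c → componentFlat b c ∈ flats
      place false = ∈-++⁺ˡ (∈-map⁺ _ b∈)
      place true  = ∈-++⁺ʳ (map (λ b → componentFlat b false) G) (∈-map⁺ _ b∈)

  affinity-affineComponents : AffinityIs m f (2 * affineComponents to ∸ 2)
  affinity-affineComponents = subst (AffinityIs m f) count≡ affinity
    where
    count≡ : 2 * count nonzeroAffineComponentᵇ (allV (suc m)) ≡ 2 * affineComponents to ∸ 2
    count≡ = begin
      2 * k                        ≡⟨ *-distribˡ-∸ 2 (suc k) 1 ⟩
      2 * suc k ∸ 2                ≡⟨ cong (λ j → 2 * j ∸ 2) |C|≡1+k ⟨
      2 * affineComponents to ∸ 2  ∎
      where
      open ≡-Reasoning
      k = count nonzeroAffineComponentᵇ (allV (suc m))
      |C|≡1+k = count-nonzero (isAffineComponentᵇ to) (zero-isAffineComponent to)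

AffinityIs-functional : ∀ {n k} {f : Per n} {m m′} → AffinityIs k f m → AffinityIs k f m′ → m ≡ m′
AffinityIs-functional (L , L-unique , |L| , L⇔) (M , M-unique , |M| , M⇔) =
  trans (sym |L|) (trans (∈⇔⇒length≡ L-unique M-unique same-members) |M|)
  where
  same-members : ∀ X → X ∈ L ⇔ X ∈ M
  same-members X = mk⇔ (Equivalence.from (M⇔ X) ∘ Equivalence.to (L⇔ X))
                       (Equivalence.from (L⇔ X) ∘ Equivalence.to (M⇔ X))

-- Products of permutations

take-++ : ∀ {p q} (x : V p) (y : V q) → take p (x ++ᵛ y) ≡ x
take-++ {p} x y = ++-injectiveˡ _ x (take++drop≡id p (x ++ᵛ y))

drop-++ : ∀ {p q} (x : V p) (y : V q) → drop p (x ++ᵛ y) ≡ y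
drop-++ {p} x y = ++-injectiveʳ _ x (take++drop≡id p (x ++ᵛ y))

·-++ : ∀ {p q} (a x : V p) (b y : V q) → (a ++ᵛ b) · (x ++ᵛ y) ≡ a · x xor b · y
·-++ []       []       b y = refl
·-++ (a ∷ as) (x ∷ xs) b y =
  trans (cong ((a ∧ x) xor_) (·-++ as xs b y)) (sym (xor-assoc (a ∧ x) (as · xs) (b · y)))

·-++ʳ : ∀ p {q} (a : V (p + q)) (x : V p) (y : V q) → a · (x ++ᵛ y) ≡ take p a · x xor drop p a · y
·-++ʳ p a x y = trans (cong (_· (x ++ᵛ y)) (sym (take++drop≡id p a))) (·-++ (take p a) x (drop p a) y)

Affine-restrictˡ : ∀ {p q} {g : V (p + q) → Bool} → Affine g → ∀ y → Affine (λ x → g (x ++ᵛ y))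
Affine-restrictˡ {p} {g = g} (a , c , g≡) y = take p a , drop p a · y xor c , λ x → begin
  g (x ++ᵛ y)                                ≡⟨ g≡ (x ++ᵛ y) ⟩
  a · (x ++ᵛ y) xor c                        ≡⟨ cong (_xor c) (·-++ʳ p a x y) ⟩
  (take p a · x xor drop p a · y) xor c      ≡⟨ xor-assoc (take p a · x) (drop p a · y) c ⟩
  take p a · x xor (drop p a · y xor c)      ∎
  where open ≡-Reasoning

Affine-restrictʳ : ∀ {p q} {g : V (p + q) → Bool} → Affine g → ∀ x → Affine (λ y → g (x ++ᵛ y))
Affine-restrictʳ {p} {g = g} (a , c , g≡) x = drop p a , take p a · x xor c , λ y → begin
  g (x ++ᵛ y)                                ≡⟨ g≡ (x ++ᵛ y) ⟩
  a · (x ++ᵛ y) xor c                        ≡⟨ cong (_xor c) (·-++ʳ p a x y) ⟩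
  (take p a · x xor drop p a · y) xor c      ≡⟨ xy∙z≈y∙xz (take p a · x) (drop p a · y) c ⟩
  drop p a · y xor (take p a · x xor c)      ∎
  where open ≡-Reasoning

Affine-separable : ∀ p {q} (A : V p → Bool) (B : V q → Bool) →
  Affine (λ z → A (take p z) xor B (drop p z)) ⇔ (Affine A × Affine B)
Affine-separable p {q} A B = mk⇔ split join
  where
  open ≡-Reasoning
  S : V (p + q) → Bool
  S z = A (take p z) xor B (drop p z)
  split : Affine S → Affine A × Affine B
  split S-affine =
    Affine-cong restrictA (Affine-xor (Affine-restrictˡ S-affine zeroV) (Affine-const (B zeroV))) ,
    Affine-cong restrictB (Affine-xor (Affine-restrictʳ S-affine zeroV) (Affine-const (A zeroV)))
    where
    restrictA : ∀ x → S (x ++ᵛ zeroV) xor B zeroV ≡ A x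
    restrictA x = begin
      (A (take p (x ++ᵛ zeroV)) xor B (drop p (x ++ᵛ zeroV))) xor B zeroV
        ≡⟨ cong₂ (λ u v → (A u xor B v) xor B zeroV) (take-++ x zeroV) (drop-++ x zeroV) ⟩
      (A x xor B zeroV) xor B zeroV  ≡⟨ xor-cancelʳ (A x) (B zeroV) ⟩
      A x                            ∎
    restrictB : ∀ y → S (zeroV ++ᵛ y) xor A zeroV ≡ B y
    restrictB y = begin
      (A (take p (zeroV ++ᵛ y)) xor B (drop p (zeroV ++ᵛ y))) xor A zeroV
        ≡⟨ cong₂ (λ u v → (A u xor B v) xor A zeroV) (take-++ (zeroV {p}) y) (drop-++ (zeroV {p}) y) ⟩
      (A zeroV xor B y) xor A zeroV  ≡⟨ cong (_xor A zeroV) (xor-comm (A zeroV) (B y)) ⟩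
      (B y xor A zeroV) xor A zeroV  ≡⟨ xor-cancelʳ (B y) (A zeroV) ⟩
      B y                            ∎
  join : Affine A × Affine B → Affine S
  join ((a₁ , c₁ , A≡) , (a₂ , c₂ , B≡)) = a₁ ++ᵛ a₂ , c₁ xor c₂ , λ z → begin
    S z
      ≡⟨ cong₂ _xor_ (A≡ (take p z)) (B≡ (drop p z)) ⟩
    (a₁ · take p z xor c₁) xor (a₂ · drop p z xor c₂)
      ≡⟨ xor-interchange (a₁ · take p z) c₁ (a₂ · drop p z) c₂ ⟩
    (a₁ · take p z xor a₂ · drop p z) xor (c₁ xor c₂)
      ≡⟨ cong (_xor (c₁ xor c₂)) (·-++ a₁ (take p z) a₂ (drop p z)) ⟨
    (a₁ ++ᵛ a₂) · (take p z ++ᵛ drop p z) xor (c₁ xor c₂)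
      ≡⟨ cong (λ w → (a₁ ++ᵛ a₂) · w xor (c₁ xor c₂)) (take++drop≡id p z) ⟩
    (a₁ ++ᵛ a₂) · z xor (c₁ xor c₂)
      ∎

isAffineᵇ-separable : ∀ p {q} (A : V p → Bool) (B : V q → Bool) →
  isAffineᵇ (λ z → A (take p z) xor B (drop p z)) ≡ isAffineᵇ A ∧ isAffineᵇ B
isAffineᵇ-separable p A B = ≡true⇔⇒≡
  (λ e → let A-affine , B-affine = Equivalence.to (Affine-separable p A B) (isAffineᵇ⇒Affine _ e) in
         cong₂ _∧_ (Affine⇒isAffineᵇ A A-affine) (Affine⇒isAffineᵇ B B-affine))
  (λ e → Affine⇒isAffineᵇ _ (Equivalence.from (Affine-separable p A B)
           (isAffineᵇ⇒Affine A (∧-conicalˡ _ _ e) , isAffineᵇ⇒Affine B (∧-conicalʳ (isAffineᵇ A) _ e))))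

count-separable : ∀ p {q} (A : V p → Bool) (B : V q → Bool) →
  count (λ z → A (take p z) ∧ B (drop p z)) (allV (p + q)) ≡ count A (allV p) * count B (allV q)
count-separable zero    {q} A B with A []
... | true  = sym (+-identityʳ (count B (allV q)))
... | false = count-false (allV q)
count-separable (suc p) {q} A B = begin
  count (λ z → A (take (suc p) z) ∧ B (drop (suc p) z)) (allV (suc p + q))
    ≡⟨ count-allV-suc (λ z → A (take (suc p) z) ∧ B (drop (suc p) z)) ⟩
  count (λ z → A (false ∷ take p z) ∧ B (drop p z)) (allV (p + q)) +
  count (λ z → A (true ∷ take p z) ∧ B (drop p z)) (allV (p + q))
    ≡⟨ cong₂ _+_ (count-separable p (A ∘ (false ∷_)) B) (count-separable p (A ∘ (true ∷_)) B) ⟩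
  count (A ∘ (false ∷_)) (allV p) * count B (allV q) + count (A ∘ (true ∷_)) (allV p) * count B (allV q)
    ≡⟨ *-distribʳ-+ (count B (allV q)) (count (A ∘ (false ∷_)) (allV p)) _ ⟨
  (count (A ∘ (false ∷_)) (allV p) + count (A ∘ (true ∷_)) (allV p)) * count B (allV q)
    ≡⟨ cong (_* count B (allV q)) (count-allV-suc A) ⟨
  count A (allV (suc p)) * count B (allV q) ∎
  where open ≡-Reasoning

_×ᶠ_ : ∀ {p q} → (V p → V p) → (V q → V q) → V (p + q) → V (p + q)
_×ᶠ_ {p} g h z = g (take p z) ++ᵛ h (drop p z)

×ᶠ-inverse : ∀ {p q} (g g′ : V p → V p) (h h′ : V q → V q) →
  (∀ x → g (g′ x) ≡ x) → (∀ y → h (h′ y) ≡ y) → ∀ z → (g ×ᶠ h) ((g′ ×ᶠ h′) z) ≡ z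
×ᶠ-inverse {p} g g′ h h′ gg′ hh′ z = begin
  g (take p w) ++ᵛ h (drop p w)
    ≡⟨ cong₂ (λ u v → g u ++ᵛ h v) (take-++ (g′ (take p z)) _) (drop-++ (g′ (take p z)) _) ⟩
  g (g′ (take p z)) ++ᵛ h (h′ (drop p z))  ≡⟨ cong₂ _++ᵛ_ (gg′ _) (hh′ _) ⟩
  take p z ++ᵛ drop p z                    ≡⟨ take++drop≡id p z ⟩
  z                                        ∎
  where
  open ≡-Reasoning
  w = g′ (take p z) ++ᵛ h′ (drop p z)

_×ᴾ_ : ∀ {p q} → Per p → Per q → Per (p + q)
f ×ᴾ g = mk↔ₛ′ (to f ×ᶠ to g) (from f ×ᶠ from g)
  (×ᶠ-inverse (to f) (from f) (to g) (from g) (strictlyInverseˡ f) (strictlyInverseˡ g))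
  (×ᶠ-inverse (from f) (to f) (from g) (to g) (strictlyInverseʳ f) (strictlyInverseʳ g))
  where open Inverse

affineComponents-× : ∀ {p q} (g : V p → V p) (h : V q → V q) →
  affineComponents (g ×ᶠ h) ≡ affineComponents g * affineComponents h
affineComponents-× {p} g h =
  trans (count-cong split (allV _)) (count-separable p (isAffineComponentᵇ g) (isAffineComponentᵇ h))
  where
  split : ∀ b → isAffineComponentᵇ (g ×ᶠ h) b ≡
                isAffineComponentᵇ g (take p b) ∧ isAffineComponentᵇ h (drop p b)
  split b = trans (isAffineᵇ-cong (λ z → ·-++ʳ p b (g (take p z)) (h (drop p z))))
                  (isAffineᵇ-separable p (λ x → take p b · g x) (λ y → drop p b · h y))

affineComponents-id : ∀ k → affineComponents {k} id ≡ 2 ^ k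
affineComponents-id k = begin
  count (isAffineComponentᵇ id) (allV k)  ≡⟨ count-cong linear (allV k) ⟩
  count (λ _ → true) (allV k)             ≡⟨ count-true (allV k) ⟩
  length (allV k)                         ≡⟨ length-allV k ⟩
  2 ^ k                                   ∎
  where
  open ≡-Reasoning
  linear : ∀ b → isAffineComponentᵇ id b ≡ true
  linear b = Affine⇒isAffineᵇ _ (b , false , λ x → sym (xor-identityʳ (b · x)))

-- Permutations with 2ᵈ affine components

bits : ∀ n → ℕ → V n
bits zero    k = []
bits (suc n) k with 2 ^ n ≤ᵇ k
... | true  = true  ∷ bits n (k ∸ 2 ^ n)
... | false = false ∷ bits n k

index : ∀ {n} → V n → ℕ
index         []      = 0
index {suc n} (b ∷ x) = (if b then 2 ^ n else 0) + index x

-- Entry i of the table is the image of the point whose binary expansion, most significant bit first, is i.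
tableMap : ∀ n → List ℕ → V n → V n
tableMap n t x = bits n (fromMaybe 0 (head (List.drop (index x) t)))

invert : ∀ {n} → (V n → V n) → V n → V n
invert {n} g y = fromMaybe y (findᵇ (λ x → eqV (g x) y) (allV n))

checkedPermutation : ∀ {n} (g h : V n → V n) →
  all (λ y → eqV (g (h y)) y) (allV n) ≡ true → all (λ x → eqV (h (g x)) x) (allV n) ≡ true → Per n
checkedPermutation g h gh hg = mk↔ₛ′ g h
  (λ y → eqV⇒≡ {x = g (h y)} (all-allV⁻ _ gh y))
  (λ x → eqV⇒≡ {x = h (g x)} (all-allV⁻ _ hg x))

tablePermutation : ∀ n (t : List ℕ) →
  all (λ y → eqV (tableMap n t (invert (tableMap n t) y)) y) (allV n) ≡ true →
  all (λ x → eqV (invert (tableMap n t) (tableMap n t x)) x) (allV n) ≡ true → Per n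
tablePermutation n t = checkedPermutation (tableMap n t) (invert (tableMap n t))

-- The tables were found by computer search.
π₃ : Per 3
π₃ = tablePermutation 3 (6 ∷ 1 ∷ 4 ∷ 5 ∷ 3 ∷ 0 ∷ 2 ∷ 7 ∷ []) refl refl

π₄ : Per 4
π₄ = tablePermutation 4 (0 ∷ 2 ∷ 13 ∷ 3 ∷ 4 ∷ 14 ∷ 6 ∷ 9 ∷ 7 ∷ 1 ∷ 5 ∷ 10 ∷ 12 ∷ 15 ∷ 8 ∷ 11 ∷ []) refl refl

π₅ : Per 5
π₅ = tablePermutation 5
  (14 ∷ 11 ∷ 2 ∷ 29 ∷ 13 ∷ 10 ∷ 3 ∷ 17 ∷ 4 ∷ 30 ∷ 23 ∷ 28 ∷ 27 ∷ 8 ∷ 26 ∷ 24 ∷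
   6 ∷ 0 ∷ 7 ∷ 16 ∷ 21 ∷ 5 ∷ 20 ∷ 12 ∷ 25 ∷ 18 ∷ 19 ∷ 22 ∷ 9 ∷ 31 ∷ 15 ∷ 1 ∷ []) refl refl

ρ₁ : Per 3
ρ₁ = tablePermutation 3 (7 ∷ 0 ∷ 6 ∷ 3 ∷ 4 ∷ 2 ∷ 5 ∷ 1 ∷ []) refl refl

ρ₂ : Per 3
ρ₂ = tablePermutation 3 (6 ∷ 0 ∷ 2 ∷ 4 ∷ 3 ∷ 5 ∷ 1 ∷ 7 ∷ []) refl refl

affineComponents-π₃ : affineComponents (Inverse.to π₃) ≡ 1
affineComponents-π₃ = refl

affineComponents-π₄ : affineComponents (Inverse.to π₄) ≡ 1
affineComponents-π₄ = refl

affineComponents-π₅ : affineComponents (Inverse.to π₅) ≡ 1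
affineComponents-π₅ = refl

affineComponents-ρ₁ : affineComponents (Inverse.to ρ₁) ≡ 2
affineComponents-ρ₁ = refl

affineComponents-ρ₂ : affineComponents (Inverse.to ρ₂) ≡ 4
affineComponents-ρ₂ = refl

trivialComponents : ∀ j → Σ (Per (3 + j)) λ f → affineComponents (Inverse.to f) ≡ 1
trivialComponents 0                   = π₃ , affineComponents-π₃
trivialComponents 1                   = π₄ , affineComponents-π₄
trivialComponents 2                   = π₅ , affineComponents-π₅
trivialComponents (suc (suc (suc j))) =
  let f , |C| = trivialComponents j in
  π₃ ×ᴾ f , trans (affineComponents-× (Inverse.to π₃) (Inverse.to f))
                  (cong₂ _*_ affineComponents-π₃ |C|)

components-by-codimension : ∀ k d → 3 ≤ k + d →
  Σ (Per (k + d)) λ f → affineComponents (Inverse.to f) ≡ 2 ^ d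
components-by-codimension 0 d _ = ↔-id (V d) , affineComponents-id d
components-by-codimension 1 0             (s≤s ())
components-by-codimension 1 1             (s≤s (s≤s ()))
components-by-codimension 1 (suc (suc d)) _ = ρ₂ ×ᴾ ↔-id (V d) , (begin
  affineComponents (Inverse.to (ρ₂ ×ᴾ ↔-id (V d)))
    ≡⟨ affineComponents-× (Inverse.to ρ₂) (id {A = V d}) ⟩
  affineComponents (Inverse.to ρ₂) * affineComponents {d} id
    ≡⟨ cong₂ _*_ affineComponents-ρ₂ (affineComponents-id d) ⟩
  4 * 2 ^ d
    ≡⟨ *-assoc 2 2 (2 ^ d) ⟩
  2 ^ suc (suc d)
    ∎)
  where open ≡-Reasoning
components-by-codimension 2 0       (s≤s (s≤s ()))
components-by-codimension 2 (suc d) _ = ρ₁ ×ᴾ ↔-id (V d) ,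
  trans (affineComponents-× (Inverse.to ρ₁) (id {A = V d}))
        (cong₂ _*_ affineComponents-ρ₁ (affineComponents-id d))
components-by-codimension (suc (suc (suc j))) d _ =
  let f , |C| = trivialComponents j in
  f ×ᴾ ↔-id (V d) , trans (affineComponents-× (Inverse.to f) (id {A = V d}))
    (trans (cong₂ _*_ |C| (affineComponents-id d)) (*-identityˡ (2 ^ d)))

permutation-with-components : ∀ {n d} → 3 ≤ n → d ≤ n →
  Σ (Per n) λ f → affineComponents (Inverse.to f) ≡ 2 ^ d
permutation-with-components {n} {d} 3≤n d≤n =
  subst (λ n → Σ (Per n) λ f → affineComponents (Inverse.to f) ≡ 2 ^ d) (m∸n+n≡m d≤n)
    (components-by-codimension (n ∸ d) d (subst (3 ≤_) (sym (m∸n+n≡m d≤n)) 3≤n))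

theorem5p2 : ∀ (n : ℕ) → 2 < n → ∀ (m : ℕ) →
    (∃ λ (f : Per n) → AffinityIs (n ∸ 1) f m) ⇔
    (∃ λ (i : ℕ) → 1 ≤ i × i ≤ suc n × m ≡ 2 ^ i ∸ 2)
theorem5p2 zero    ()  _
theorem5p2 (suc n) 2<n m = mk⇔ forth back
  where
  forth : (∃ λ f → AffinityIs n f m) → ∃ λ i → 1 ≤ i × i ≤ suc (suc n) × m ≡ 2 ^ i ∸ 2
  forth (f , affinity-m) =
    let d , d≤n , |C| = affineComponents-size (Inverse.to f) in
    suc d , s≤s z≤n , s≤s d≤n ,
    trans (AffinityIs-functional {f = f} affinity-m (affinity-affineComponents f))
          (cong (λ k → 2 * k ∸ 2) |C|)
  back : (∃ λ i → 1 ≤ i × i ≤ suc (suc n) × m ≡ 2 ^ i ∸ 2) → ∃ λ f → AffinityIs n f m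
  back (suc d , _ , s≤s d≤n , refl) =
    let f , |C| = permutation-with-components 2<n d≤n in
    f , subst (λ k → AffinityIs n f (2 * k ∸ 2)) |C| (affinity-affineComponents f)
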